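{- For every integer $n\geq 2$, the stacked rectangular prism $Y_{4,n}=C_4\square P_n$ is total prime.
   Context: All graphs are finite and simple. For a graph $G$ with vertex set $V$ and edge set $E$, a total prime labeling is a bijection $\ell: V\cup E\to\{1,2,\ldots,|V|+|E|\}$ such that (i) for every pair of adjacent vertices $u,v$, $\gcd(\ell(u),\ell(v))=1$, and (ii) for every vertex $v$ of degree at least 2, the greatest common divisor of the labels $\ell(uv)$ over all edges $uv$ incident to $v$ equals 1. A graph is total prime if it admits a total prime labeling. $C_4\square P_n$ denotes the Cartesian product of the 4-cycle and the path on $n$ vertices. -}

module Defs where

open import Data.Nat using (ℕ; zero; suc; _+_; _*_; _≤_)
open import Data.Nat.Divisibility using (_∣_)
open import Data.Nat.Coprimality using (Coprime)
open import Data.Fin using (Fin; zero; suc; toℕ; inject₁; splitAt; combine; remQuot)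
open import Data.Product using (_×_; _,_; proj₁; proj₂; Σ; ∃)
open import Data.Sum using (_⊎_; inj₁; inj₂)
open import Relation.Binary.PropositionalEquality using (_≡_; _≢_)
open import Function.Bundles using (_⤖_; Bijection)

-- A finite graph with vertex set Fin nV and edge set Fin nE;
-- each edge has two (ordered, for bookkeeping only) endpoints.
record Graph : Set where
  field
    nV    : ℕ
    nE    : ℕ
    ends  : Fin nE → Fin nV × Fin nV

open Graph public

Incident : (G : Graph) → Fin (nE G) → Fin (nV G) → Set
Incident G e v = (proj₁ (ends G e) ≡ v) ⊎ (proj₂ (ends G e) ≡ v)

DegAtLeast2 : (G : Graph) → Fin (nV G) → Set
DegAtLeast2 G v = Σ (Fin (nE G)) λ e₁ → Σ (Fin (nE G)) λ e₂ →
  (e₁ ≢ e₂) × Incident G e₁ v × Incident G e₂ v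

-- A total prime labeling: a bijection V ⊎ E → Fin (|V|+|E|); the label of x is
-- 1 + toℕ (f x), so labels range over {1,…,|V|+|E|}.
record TotalPrimeLabeling (G : Graph) : Set where
  field
    f : (Fin (nV G) ⊎ Fin (nE G)) ⤖ Fin (nV G + nE G)
  label : Fin (nV G) ⊎ Fin (nE G) → ℕ
  label x = suc (toℕ (Bijection.to f x))
  field
    vertexCond : ∀ e → Coprime (label (inj₁ (proj₁ (ends G e))))
                               (label (inj₁ (proj₂ (ends G e))))
    edgeCond : ∀ v → DegAtLeast2 G v →
               ∀ d → (∀ e → Incident G e v → d ∣ label (inj₂ e)) → d ≡ 1

TotalPrime : Graph → Set
TotalPrime G = TotalPrimeLabeling G

next4 : Fin 4 → Fin 4
next4 zero = suc zero
next4 (suc zero) = suc (suc zero)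
next4 (suc (suc zero)) = suc (suc (suc zero))
next4 (suc (suc (suc zero))) = zero

-- C₄ □ P_{m+1}: vertex (i , j) with i ∈ Z/4, j ∈ {0..m} encoded as combine i j.
-- Edges: 4(m+1) cycle edges (i,j)-(i+1,j), then 4m path edges (i,j)-(i,j+1).
C4□P-suc : ℕ → Graph
C4□P-suc m = record
  { nV = 4 * suc m
  ; nE = 4 * suc m + 4 * m
  ; ends = e
  }
  where
  e : Fin (4 * suc m + 4 * m) → Fin (4 * suc m) × Fin (4 * suc m)
  e x with splitAt (4 * suc m) x
  ... | inj₁ c with remQuot {4} (suc m) c
  ...   | (i , j) = combine {4} {suc m} i j , combine {4} {suc m} (next4 i) j
  e x | inj₂ p with remQuot {4} m p
  ...   | (i , j) = combine {4} {suc m} i (inject₁ j) , combine {4} {suc m} i (suc j)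

-- C₄ □ P_n  (P_n = path on n vertices); n = 0 gives the empty graph
C4□P : ℕ → Graph
C4□P zero = record { nV = 0 ; nE = 0 ; ends = λ () }
C4□P (suc m) = C4□P-suc m

module Submission where

-- Layer k < m of C₄ □ P_{m+1}, together with the four path edges leaving it, is labelled by the block
-- 12k+1, …, 12k+12 in one fixed pattern, and the last layer by 12m+1, …, 12m+8.  Block vertices get the
-- residues 1, 5, 11, 7 (mod 12), so two adjacent vertices have labels x and x + d with x prime to 12 and
-- d ∣ 12² (d = 3, 4, 6, 9, 12), or consecutive labels; either way they are coprime.  Every vertex meets
-- two edges with consecutive labels, except the first vertex of the last layer, whose cycle edges are
-- labelled 12m+5 and 12m+8.

open import Defs
open import Data.Nat using (ℕ; zero; suc; _+_; _*_; _^_; _≤_)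
open import Data.Nat.Properties using (+-suc; +-assoc; +-comm; *-comm)
open import Data.Nat.Divisibility using (_∣_; divides; ∣-refl; ∣-trans; ∣m+n∣m⇒∣n; ∣m⇒∣m*n)
open import Data.Nat.Coprimality using (Coprime; coprime-+; coprime-divisor; 1-coprimeTo; gcd≡1⇒coprime)
import Data.Nat.Coprimality as Coprime
open import Data.Nat.Tactic.RingSolver using (solve-∀)
open import Data.Fin
  using (Fin; suc; toℕ; fromℕ; inject₁; cast; join; splitAt; combine; remQuot; _↑ˡ_; _↑ʳ_; #_)
open import Data.Fin.Patterns using (0F; 1F; 2F; 3F)
open import Data.Fin.Properties
  using ( +↔⊎; *↔×; all?; _≟_; remQuot-combine; cast-involutive
        ; toℕ-cast; toℕ-combine; toℕ-↑ˡ; toℕ-↑ʳ; toℕ-fromℕ; toℕ-inject₁)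
open import Data.Fin.Relation.Unary.Top using (View; view; ‵fromℕ; ‵inject₁; view-fromℕ; view-inject₁)
open import Data.Product using (_×_; _,_; proj₁; proj₂; ∃₂; uncurry)
import Data.Product as Product
open import Data.Sum using (_⊎_; inj₁; inj₂)
open import Data.Sum.Function.Propositional using (_⊎-↔_)
open import Data.Vec using (_∷_; []; lookup)
open import Function using (_∘_)
open import Function.Bundles using (_↔_; Inverse; Injection; mk↔ₛ′)
open import Function.Properties.Inverse using (↔-sym; ↔-trans; ↔⇒⤖; Inverse⇒Injection)
open import Relation.Binary.PropositionalEquality
open import Relation.Nullary.Decidable using (from-yes)

open Inverse using (to; from; strictlyInverseˡ)

private variable a b d k m n t : ℕ

coprime-≡ : m ≡ a → n ≡ b → Coprime a b → Coprime m n
coprime-≡ refl refl a⊥b = a⊥b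

coprime-∣ : Coprime m n → d ∣ n → Coprime m d
coprime-∣ m⊥n d∣n (c∣m , c∣d) = m⊥n (c∣m , ∣-trans c∣d d∣n)

coprime-* : Coprime m n → Coprime m k → Coprime m (n * k)
coprime-* {m} {n} m⊥n m⊥k {c} (c∣m , c∣nk) = m⊥k (c∣m , coprime-divisor c⊥n c∣nk)
  where
  c⊥n : Coprime c n
  c⊥n (e∣c , e∣n) = m⊥n (∣-trans e∣c c∣m , e∣n)

coprime-^ : ∀ k → Coprime m n → Coprime m (n ^ k)
coprime-^ {m} zero    _   = Coprime.sym (1-coprimeTo m)
coprime-^     (suc k) m⊥n = coprime-* m⊥n (coprime-^ k m⊥n)

coprime-*+ : ∀ t → Coprime a n → Coprime (n * t + a) n
coprime-*+ t a⊥n (c∣nt+a , c∣n) = a⊥n (∣m+n∣m⇒∣n c∣nt+a (∣m⇒∣m*n t c∣n) , c∣n)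

coprime-+ʳ : Coprime m d → Coprime m (m + d)
coprime-+ʳ m⊥d = Coprime.sym (coprime-+ (Coprime.sym m⊥d))

coprime-suc : ∀ n → Coprime n (suc n)
coprime-suc n = subst (Coprime n) (+-comm n 1) (coprime-+ʳ (Coprime.sym (1-coprimeTo n)))

coprime-+suc : ∀ n a → Coprime (n + a) (n + suc a)
coprime-+suc n a = subst (Coprime (n + a)) (sym (+-suc n a)) (coprime-suc (n + a))

coprime-offset : ∀ k t → Coprime a n → d ∣ n ^ k → Coprime (n * t + a) (n * t + (a + d))
coprime-offset {a} {n} {d} k t a⊥n d∣nᵏ =
  subst (Coprime (n * t + a)) (+-assoc (n * t) a d)
    (coprime-+ʳ (coprime-∣ (coprime-^ k (coprime-*+ t a⊥n)) d∣nᵏ))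

coprime-next-offset : ∀ k t → Coprime a n → d ∣ n ^ k → b + n ≡ a + d →
                      Coprime (n * t + a) (n * suc t + b)
coprime-next-offset {a} {n} {d} {b} k t a⊥n d∣nᵏ b+n≡a+d =
  subst (Coprime (n * t + a)) shift (coprime-offset k t a⊥n d∣nᵏ)
  where
  +-*-suc : ∀ n t b → n * t + (b + n) ≡ n * suc t + b
  +-*-suc = solve-∀

  shift : n * t + (a + d) ≡ n * suc t + b
  shift = trans (cong (n * t +_) (sym b+n≡a+d)) (+-*-suc n t b)

record Presentation (G : Graph) : Set₁ where
  field
    Vertex Edge    : Set
    vertices       : Fin (nV G) ↔ Vertex
    edges          : Fin (nE G) ↔ Edge
    endpoints      : Edge → Vertex × Vertex
    ends-endpoints : ∀ e → Product.map (to vertices) (to vertices) (ends G e) ≡ endpoints (to edges e)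

  _∈_ : Vertex → Edge → Set
  v ∈ ε = proj₁ (endpoints ε) ≡ v ⊎ proj₂ (endpoints ε) ≡ v

  record Labeling : Set where
    field
      numbering        : (Vertex ⊎ Edge) ↔ Fin (nV G + nE G)
      label            : Vertex ⊎ Edge → ℕ
      numbering-label  : ∀ x → suc (toℕ (to numbering x)) ≡ label x
      adjacent-coprime : ∀ ε → Coprime (label (inj₁ (proj₁ (endpoints ε))))
                                       (label (inj₁ (proj₂ (endpoints ε))))
      incident-coprime : ∀ v → ∃₂ λ ε₁ ε₂ → v ∈ ε₁ × v ∈ ε₂ ×
                                 Coprime (label (inj₂ ε₁)) (label (inj₂ ε₂))

  ends-from : ∀ ε → Product.map (to vertices) (to vertices) (ends G (from edges ε)) ≡ endpoints ε
  ends-from ε = trans (ends-endpoints (from edges ε)) (cong endpoints (strictlyInverseˡ edges ε))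

  vertices-injective : ∀ {v w} → to vertices v ≡ to vertices w → v ≡ w
  vertices-injective = Injection.injective (Inverse⇒Injection vertices)

  incident-from : ∀ {v ε} → to vertices v ∈ ε → Incident G (from edges ε) v
  incident-from {ε = ε} (inj₁ eq) = inj₁ (vertices-injective (trans (cong proj₁ (ends-from ε)) eq))
  incident-from {ε = ε} (inj₂ eq) = inj₂ (vertices-injective (trans (cong proj₂ (ends-from ε)) eq))

  totalPrime : Labeling → TotalPrime G
  totalPrime L = record
    { f = ↔⇒⤖ (↔-trans (vertices ⊎-↔ edges) numbering) ; vertexCond = vertexCond ; edgeCond = edgeCond }
    where
    open Labeling L

    number : Vertex ⊎ Edge → ℕ
    number x = suc (toℕ (to numbering x))

    vertexCond : ∀ e → Coprime (number (inj₁ (to vertices (proj₁ (ends G e)))))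
                               (number (inj₁ (to vertices (proj₂ (ends G e)))))
    vertexCond e = coprime-≡
      (trans (numbering-label _) (cong (label ∘ inj₁ ∘ proj₁) (ends-endpoints e)))
      (trans (numbering-label _) (cong (label ∘ inj₁ ∘ proj₂) (ends-endpoints e)))
      (adjacent-coprime (to edges e))

    edgeCond : ∀ v → DegAtLeast2 G v → ∀ d →
               (∀ e → Incident G e v → d ∣ number (inj₂ (to edges e))) → d ≡ 1
    edgeCond v _ d d∣ with incident-coprime (to vertices v)
    ... | ε₁ , ε₂ , v∈ε₁ , v∈ε₂ , ε₁⊥ε₂ = ε₁⊥ε₂ (divides-label v∈ε₁ , divides-label v∈ε₂)
      where
      divides-label : ∀ {ε} → to vertices v ∈ ε → d ∣ label (inj₂ ε)
      divides-label {ε} v∈ε = subst (d ∣_)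
        (trans (numbering-label _) (cong (label ∘ inj₂) (strictlyInverseˡ edges ε)))
        (d∣ (from edges ε) (incident-from v∈ε))

Vertex : ℕ → Set
Vertex m = Fin 4 × Fin (suc m)

Edge : ℕ → Set
Edge m = Vertex m ⊎ (Fin 4 × Fin m)

Element : ℕ → Set
Element m = Vertex m ⊎ Edge m

endpoints : Edge m → Vertex m × Vertex m
endpoints (inj₁ (i , j)) = (i , j) , (next4 i , j)
endpoints (inj₂ (i , k)) = (i , inject₁ k) , (i , suc k)

edges : Fin (4 * suc m + 4 * m) ↔ Edge m
edges {m} = ↔-trans (+↔⊎ {4 * suc m}) (*↔× ⊎-↔ *↔×)

ends-endpoints : ∀ e → Product.map (remQuot (suc m)) (remQuot (suc m)) (ends (C4□P-suc m) e)
                     ≡ endpoints (to edges e)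
ends-endpoints {m} e with splitAt (4 * suc m) e
... | inj₁ c = let i , j = remQuot {4} (suc m) c in
  cong₂ _,_ (remQuot-combine i j) (remQuot-combine (next4 i) j)
... | inj₂ p = let i , k = remQuot {4} m p in
  cong₂ _,_ (remQuot-combine i (inject₁ k)) (remQuot-combine i (suc k))

grid : ∀ m → Presentation (C4□P-suc m)
grid m = record
  { Vertex = Vertex m ; Edge = Edge m ; vertices = *↔× ; edges = edges
  ; endpoints = endpoints ; ends-endpoints = ends-endpoints }

data Kind : Set where
  vertex cycle path : Kind

position : Kind → Fin 4 → Fin 12
position vertex = lookup (# 0 ∷ # 4 ∷ # 10 ∷ # 6 ∷ [])
position cycle  = lookup (# 2 ∷ # 5 ∷ # 8 ∷ # 11 ∷ [])
position path   = lookup (# 1 ∷ # 3 ∷ # 7 ∷ # 9 ∷ [])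

kindAt : Fin 12 → Kind × Fin 4
kindAt = lookup ((vertex , 0F) ∷ (path , 0F) ∷ (cycle , 0F) ∷ (path , 1F) ∷ (vertex , 1F) ∷ (cycle , 1F) ∷
                 (vertex , 3F) ∷ (path , 2F) ∷ (cycle , 2F) ∷ (path , 3F) ∷ (vertex , 2F) ∷ (cycle , 3F) ∷ [])

position-kindAt : ∀ s → uncurry position (kindAt s) ≡ s
position-kindAt = from-yes (all? λ s → uncurry position (kindAt s) ≟ s)

kindAt-position : ∀ κ i → kindAt (position κ i) ≡ (κ , i)
kindAt-position vertex 0F = refl
kindAt-position vertex 1F = refl
kindAt-position vertex 2F = refl
kindAt-position vertex 3F = refl
kindAt-position cycle  0F = refl
kindAt-position cycle  1F = refl
kindAt-position cycle  2F = refl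
kindAt-position cycle  3F = refl
kindAt-position path   0F = refl
kindAt-position path   1F = refl
kindAt-position path   2F = refl
kindAt-position path   3F = refl

-- Block k holds layer inject₁ k and the path edges leaving it; the last layer has 8 slots of its own.
Slot : ℕ → Set
Slot m = (Fin m × Fin 12) ⊎ (Fin 4 ⊎ Fin 4)

blockElement : Fin m → Kind → Fin 4 → Element m
blockElement k vertex i = inj₁ (i , inject₁ k)
blockElement k cycle  i = inj₂ (inj₁ (i , inject₁ k))
blockElement k path   i = inj₂ (inj₂ (i , k))

place : Element m → Slot m
place (inj₁ (i , j)) with view j
... | ‵fromℕ      = inj₂ (inj₁ i)
... | ‵inject₁ k  = inj₁ (k , position vertex i)
place (inj₂ (inj₁ (i , j))) with view j
... | ‵fromℕ      = inj₂ (inj₂ i)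
... | ‵inject₁ k  = inj₁ (k , position cycle i)
place (inj₂ (inj₂ (i , k))) = inj₁ (k , position path i)

unplace : Slot m → Element m
unplace     (inj₁ (k , s))  = uncurry (blockElement k) (kindAt s)
unplace {m} (inj₂ (inj₁ i)) = inj₁ (i , fromℕ m)
unplace {m} (inj₂ (inj₂ i)) = inj₂ (inj₁ (i , fromℕ m))

place-blockElement : ∀ (k : Fin m) κ i → place (blockElement k κ i) ≡ inj₁ (k , position κ i)
place-blockElement k vertex i rewrite view-inject₁ k = refl
place-blockElement k cycle  i rewrite view-inject₁ k = refl
place-blockElement k path   i = refl

place-top-vertex : ∀ i → place {m} (inj₁ (i , fromℕ m)) ≡ inj₂ (inj₁ i)
place-top-vertex {m} i rewrite view-fromℕ m = refl

place-top-cycle : ∀ i → place {m} (inj₂ (inj₁ (i , fromℕ m))) ≡ inj₂ (inj₂ i)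
place-top-cycle {m} i rewrite view-fromℕ m = refl

place-unplace : ∀ s → place {m} (unplace s) ≡ s
place-unplace (inj₁ (k , s)) with kindAt s | position-kindAt s
... | κ , i | refl = place-blockElement k κ i
place-unplace (inj₂ (inj₁ i)) = place-top-vertex i
place-unplace (inj₂ (inj₂ i)) = place-top-cycle i

unplace-place : ∀ x → unplace {m} (place x) ≡ x
unplace-place (inj₁ (i , j)) with view j
... | ‵fromℕ     = refl
... | ‵inject₁ k = cong (uncurry (blockElement k)) (kindAt-position vertex i)
unplace-place (inj₂ (inj₁ (i , j))) with view j
... | ‵fromℕ     = refl
... | ‵inject₁ k = cong (uncurry (blockElement k)) (kindAt-position cycle i)
unplace-place (inj₂ (inj₂ (i , k))) = cong (uncurry (blockElement k)) (kindAt-position path i)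

layout : Element m ↔ Slot m
layout = mk↔ₛ′ place unplace place-unplace unplace-place

slots : Slot m ↔ Fin (m * 12 + 8)
slots {m} = ↔-sym (↔-trans (+↔⊎ {m * 12}) (*↔× ⊎-↔ +↔⊎))

cast-↔ : m ≡ n → Fin m ↔ Fin n
cast-↔ eq = mk↔ₛ′ (cast eq) (cast (sym eq)) (cast-involutive eq (sym eq)) (cast-involutive (sym eq) eq)

slot-count : ∀ m → m * 12 + 8 ≡ 4 * suc m + (4 * suc m + 4 * m)
slot-count = solve-∀

numbering : Element m ↔ Fin (4 * suc m + (4 * suc m + 4 * m))
numbering {m} = ↔-trans layout (↔-trans slots (cast-↔ (slot-count m)))

topLabel : ℕ → Fin 4 ⊎ Fin 4 → ℕ
topLabel m t = 12 * m + suc (toℕ (join 4 4 t))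

slotLabel : Slot m → ℕ
slotLabel     (inj₁ (k , s)) = 12 * toℕ k + suc (toℕ s)
slotLabel {m} (inj₂ t)       = topLabel m t

slot-number : ∀ s → suc (toℕ (to (↔-trans (slots {m}) (cast-↔ (slot-count m))) s)) ≡ slotLabel s
slot-number {m} (inj₁ (k , s)) = begin
  suc (toℕ (cast (slot-count m) (combine k s ↑ˡ 8))) ≡⟨ cong suc (toℕ-cast (slot-count m) _) ⟩
  suc (toℕ (combine k s ↑ˡ 8))                       ≡⟨ cong suc (toℕ-↑ˡ (combine k s) 8) ⟩
  suc (toℕ (combine k s))                            ≡⟨ cong suc (toℕ-combine k s) ⟩
  suc (12 * toℕ k + toℕ s)                           ≡⟨ +-suc (12 * toℕ k) (toℕ s) ⟨
  12 * toℕ k + suc (toℕ s)                           ∎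
  where open ≡-Reasoning
slot-number {m} (inj₂ t) = begin
  suc (toℕ (cast (slot-count m) (m * 12 ↑ʳ join 4 4 t))) ≡⟨ cong suc (toℕ-cast (slot-count m) _) ⟩
  suc (toℕ (m * 12 ↑ʳ join 4 4 t))                       ≡⟨ cong suc (toℕ-↑ʳ (m * 12) (join 4 4 t)) ⟩
  suc (m * 12 + toℕ (join 4 4 t))                        ≡⟨ cong (λ n → suc (n + toℕ (join 4 4 t))) (*-comm m 12) ⟩
  suc (12 * m + toℕ (join 4 4 t))                        ≡⟨ +-suc (12 * m) _ ⟨
  topLabel m t                                           ∎
  where open ≡-Reasoning

label : Element m → ℕ
label = slotLabel ∘ place

blockLabel : ℕ → Kind → Fin 4 → ℕ
blockLabel t κ i = 12 * t + suc (toℕ (position κ i))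

label-block : ∀ (k : Fin m) κ i → label (blockElement k κ i) ≡ blockLabel (toℕ k) κ i
label-block k κ i = cong slotLabel (place-blockElement k κ i)

label-top-vertex : ∀ m i → label {m} (inj₁ (i , fromℕ m)) ≡ topLabel m (inj₁ i)
label-top-vertex m i = cong slotLabel (place-top-vertex {m} i)

label-top-cycle : ∀ m i → label {m} (inj₂ (inj₁ (i , fromℕ m))) ≡ topLabel m (inj₂ i)
label-top-cycle m i = cong slotLabel (place-top-cycle {m} i)

vertexResidue-coprime : ∀ i → Coprime (suc (toℕ (position vertex i))) 12
vertexResidue-coprime 0F = gcd≡1⇒coprime refl
vertexResidue-coprime 1F = gcd≡1⇒coprime refl
vertexResidue-coprime 2F = gcd≡1⇒coprime refl
vertexResidue-coprime 3F = gcd≡1⇒coprime refl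

block-cycle-coprime : ∀ t i → Coprime (blockLabel t vertex i) (blockLabel t vertex (next4 i))
block-cycle-coprime t 0F = coprime-offset 1 t (vertexResidue-coprime 0F) (divides 3 refl)
block-cycle-coprime t 1F = coprime-offset 1 t (vertexResidue-coprime 1F) (divides 2 refl)
block-cycle-coprime t 2F = Coprime.sym (coprime-offset 1 t (vertexResidue-coprime 3F) (divides 3 refl))
block-cycle-coprime t 3F = Coprime.sym (coprime-offset 1 t (vertexResidue-coprime 0F) (divides 2 refl))

block-path-coprime : ∀ t i → Coprime (blockLabel t vertex i) (blockLabel (suc t) vertex i)
block-path-coprime t i = coprime-next-offset 1 t (vertexResidue-coprime i) ∣-refl refl

block-top-coprime : ∀ t i → Coprime (blockLabel t vertex i) (topLabel (suc t) (inj₁ i))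
block-top-coprime t 0F = coprime-next-offset 1 t (vertexResidue-coprime 0F) ∣-refl refl
block-top-coprime t 1F = coprime-next-offset 2 t (vertexResidue-coprime 1F) (divides 16 refl) refl
block-top-coprime t 2F = coprime-next-offset 1 t (vertexResidue-coprime 2F) (divides 3 refl) refl
block-top-coprime t 3F = coprime-next-offset 2 t (vertexResidue-coprime 3F) (divides 16 refl) refl

top-cycle-coprime : ∀ m i → Coprime (topLabel m (inj₁ i)) (topLabel m (inj₁ (next4 i)))
top-cycle-coprime m 0F = coprime-+suc (12 * m) 1
top-cycle-coprime m 1F = coprime-+suc (12 * m) 2
top-cycle-coprime m 2F = coprime-+suc (12 * m) 3
top-cycle-coprime m 3F = Coprime.sym (coprime-offset 1 m (1-coprimeTo 12) (divides 4 refl))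

cycle-adjacent : ∀ i {j : Fin (suc m)} → View j →
                 Coprime (label (inj₁ (i , j))) (label (inj₁ (next4 i , j)))
cycle-adjacent {m} i ‵fromℕ =
  coprime-≡ (label-top-vertex m i) (label-top-vertex m (next4 i)) (top-cycle-coprime m i)
cycle-adjacent i (‵inject₁ k) =
  coprime-≡ (label-block k vertex i) (label-block k vertex (next4 i)) (block-cycle-coprime (toℕ k) i)

path-adjacent : ∀ i {k : Fin m} → View k →
                Coprime (label (inj₁ (i , inject₁ k))) (label (inj₁ (i , suc k)))
path-adjacent {suc m} i ‵fromℕ = coprime-≡
  (trans (label-block (fromℕ m) vertex i) (cong (λ t → blockLabel t vertex i) (toℕ-fromℕ m)))
  (label-top-vertex (suc m) i) (block-top-coprime m i)
path-adjacent i (‵inject₁ k) = coprime-≡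
  (trans (label-block (inject₁ k) vertex i) (cong (λ t → blockLabel t vertex i) (toℕ-inject₁ k)))
  (label-block (suc k) vertex i) (block-path-coprime (toℕ k) i)

adjacent-coprime : ∀ ε → Coprime (label {m} (inj₁ (proj₁ (endpoints ε))))
                                 (label (inj₁ (proj₂ (endpoints ε))))
adjacent-coprime (inj₁ (i , j)) = cycle-adjacent i (view j)
adjacent-coprime (inj₂ (i , k)) = path-adjacent i (view k)

module _ {m : ℕ} where
  open Presentation (grid m) using (_∈_)

  incident-coprime : ∀ i {j : Fin (suc m)} → View j →
                     ∃₂ λ ε₁ ε₂ → (i , j) ∈ ε₁ × (i , j) ∈ ε₂ ×
                                  Coprime (label (inj₂ ε₁)) (label (inj₂ ε₂))
  incident-coprime 0F ‵fromℕ = inj₁ (0F , fromℕ m) , inj₁ (3F , fromℕ m) , inj₁ refl , inj₂ refl ,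
    coprime-≡ (label-top-cycle m 0F) (label-top-cycle m 3F)
      (coprime-offset 1 m (gcd≡1⇒coprime {5} {12} refl) (divides 4 refl))
  incident-coprime 1F ‵fromℕ = inj₁ (1F , fromℕ m) , inj₁ (0F , fromℕ m) , inj₁ refl , inj₂ refl ,
    coprime-≡ (label-top-cycle m 1F) (label-top-cycle m 0F) (Coprime.sym (coprime-+suc (12 * m) 5))
  incident-coprime 2F ‵fromℕ = inj₁ (2F , fromℕ m) , inj₁ (1F , fromℕ m) , inj₁ refl , inj₂ refl ,
    coprime-≡ (label-top-cycle m 2F) (label-top-cycle m 1F) (Coprime.sym (coprime-+suc (12 * m) 6))
  incident-coprime 3F ‵fromℕ = inj₁ (3F , fromℕ m) , inj₁ (2F , fromℕ m) , inj₁ refl , inj₂ refl ,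
    coprime-≡ (label-top-cycle m 3F) (label-top-cycle m 2F) (Coprime.sym (coprime-+suc (12 * m) 7))
  incident-coprime 0F (‵inject₁ k) = inj₁ (0F , inject₁ k) , inj₂ (0F , k) , inj₁ refl , inj₁ refl ,
    coprime-≡ (label-block k cycle 0F) (label-block k path 0F) (Coprime.sym (coprime-+suc (12 * toℕ k) 2))
  incident-coprime 1F (‵inject₁ k) = inj₁ (0F , inject₁ k) , inj₂ (1F , k) , inj₂ refl , inj₁ refl ,
    coprime-≡ (label-block k cycle 0F) (label-block k path 1F) (coprime-+suc (12 * toℕ k) 3)
  incident-coprime 2F (‵inject₁ k) = inj₁ (2F , inject₁ k) , inj₂ (2F , k) , inj₁ refl , inj₁ refl ,
    coprime-≡ (label-block k cycle 2F) (label-block k path 2F) (Coprime.sym (coprime-+suc (12 * toℕ k) 8))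
  incident-coprime 3F (‵inject₁ k) = inj₁ (2F , inject₁ k) , inj₂ (3F , k) , inj₂ refl , inj₁ refl ,
    coprime-≡ (label-block k cycle 2F) (label-block k path 3F) (coprime-+suc (12 * toℕ k) 9)

gridLabeling : ∀ m → Presentation.Labeling (grid m)
gridLabeling m = record
  { numbering        = numbering
  ; label            = label
  ; numbering-label  = slot-number ∘ place
  ; adjacent-coprime = adjacent-coprime
  ; incident-coprime = λ (i , j) → incident-coprime i (view j)
  }

mainTheorem14 : (n : ℕ) → 2 ≤ n → TotalPrime (C4□P n)
mainTheorem14 zero    ()
mainTheorem14 (suc m) _ = Presentation.totalPrime (grid m) (gridLabeling m)
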